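{- Let $\mu,\nu,\lambda$ be polynomial dominant weights of $GL_n$, let $H\in\mathcal{H}(\mu,\nu,\lambda)$, and let $T_1(H)$, $T_2(H)$ be its derived $t$-arrays. Then the dual array $T_1^*(H)=(T_1(H))^*$ satisfies $\varepsilon^{(i)}_j(T_1^*(H))\le\nu^*_i-\nu^*_{i+1}$ for all $1\le j\le i\le n-1$ if and only if $T_2(H)$ satisfies IC(2).
   Context: A polynomial dominant weight of $GL_n$ is a sequence of nonnegative integers $\nu=(\nu_1,\dots,\nu_n)$ with $\nu_1\ge\dots\ge\nu_n$; its dual is $\nu^*=(-\nu_n,-\nu_{n-1},\dots,-\nu_1)$, so $\nu^*_i=-\nu_{n+1-i}$. A $t$-array is an integer array $T=(t^{(i)}_j)_{1\le j\le i\le n}$; its dual array is $T^*=(s^{(i)}_j)$ with $s^{(i)}_j=-t^{(i)}_{i+1-j}$. $T$ satisfies IC(2) if $t^{(i)}_j\ge t^{(i+1)}_{j+1}$ for all $1\le j\le i\le n-1$. Its exponents are $\varepsilon^{(i)}_j(T)=\sum_{1\le h<j}(t^{(i+1)}_h-2t^{(i)}_h+t^{(i-1)}_h)+(t^{(i+1)}_j-t^{(i)}_j)$ for $1\le j\le i\le n-1$. An $h$-array is an array of nonnegative integers $H=(h_{a,b})_{0\le a\le b\le n}$ with $h_{0,0}=0$; $\mathcal{H}(\mu,\nu,\lambda)$ is the set of $h$-arrays with $h_{0,i}=\mu_1+\dots+\mu_i$, $h_{i,n}=\sum_{j=1}^n\mu_j+\nu_1+\dots+\nu_i$, $h_{i,i}=\lambda_1+\dots+\lambda_i$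 for $1\le i\le n$. The derived $t$-arrays $T_1(H)=(x^{(i)}_j)$, $T_2(H)=(y^{(i)}_j)$ are defined, for $0\le a\le b\le n-1$, by $x^{(n-a)}_{b+1-a}=h_{a,b+1}-h_{a,b}$ and $y^{(b+1)}_{a+1}=h_{a+1,b+1}-h_{a,b+1}$. -}

module Defs where

open import Data.Nat using (ℕ; zero; suc; _∸_) renaming (_+_ to _+ℕ_; _≤_ to _≤ℕ_; _<_ to _<ℕ_)
open import Data.Integer using (ℤ; +_; _+_; _-_; -_; _*_)
open import Relation.Binary.PropositionalEquality using (_≡_)
open import Data.Product using (_×_)

sumTo : ℕ → (ℕ → ℤ) → ℤ
sumTo zero    f = + 0
sumTo (suc k) f = sumTo k f + f (suc k)

sumToℕ : ℕ → (ℕ → ℕ) → ℕ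
sumToℕ zero    f = 0
sumToℕ (suc k) f = sumToℕ k f +ℕ f (suc k)

-- A weight of GL_n is given by its entries ν 1, …, ν n (values at other
-- indices are irrelevant and never used).
Weight : Set
Weight = ℕ → ℕ

-- polynomial dominant: nonnegative (by ℕ) and ν_1 ≥ ν_2 ≥ … ≥ ν_n
Dominant : ℕ → Weight → Set
Dominant n ν = ∀ i → 1 ≤ℕ i → i <ℕ n → ν (suc i) ≤ℕ ν i

dualWeight : ℕ → Weight → ℕ → ℤ
dualWeight n ν i = - (+ ν (suc n ∸ i))

-- A t-array: T i j = t^{(i)}_j, meaningful for 1 ≤ j ≤ i ≤ n.
TArray : Set
TArray = ℕ → ℕ → ℤ

dualArray : TArray → TArray
dualArray T i j = - T i (suc i ∸ j)

IC2 : ℕ → TArray → Set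
IC2 n T = ∀ i j → 1 ≤ℕ j → j ≤ℕ i → i <ℕ n → T (suc i) (suc j) Data.Integer.≤ T i j

exponent : TArray → ℕ → ℕ → ℤ
exponent T i j =
  sumTo (j ∸ 1) (λ h → T (suc i) h - (+ 2) * T i h + T (i ∸ 1) h)
  + (T (suc i) j - T i j)

-- An h-array: H a b = h_{a,b}, meaningful for 0 ≤ a ≤ b ≤ n (nonnegative by ℕ).
HArray : Set
HArray = ℕ → ℕ → ℕ

InH : ℕ → Weight → Weight → Weight → HArray → Set
InH n μ ν λw H =
  (H 0 0 ≡ 0) ×
  (∀ i → 1 ≤ℕ i → i ≤ℕ n → H 0 i ≡ sumToℕ i μ) ×
  (∀ i → 1 ≤ℕ i → i ≤ℕ n → H i n ≡ sumToℕ n μ +ℕ sumToℕ i ν) ×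
  (∀ i → 1 ≤ℕ i → i ≤ℕ n → H i i ≡ sumToℕ i λw)

-- T1: x^{(n-a)}_{b+1-a} = h_{a,b+1} - h_{a,b} (0≤a≤b≤n-1);
-- reindexed with i = n-a, j = b+1-a (so a = n-i, b = n-i+j-1), 1 ≤ j ≤ i ≤ n:
--   x^{(i)}_j = h_{n-i, n-i+j} - h_{n-i, n-i+j-1}
T₁ : ℕ → HArray → TArray
T₁ n H i j = + H (n ∸ i) ((n ∸ i) +ℕ j) - + H (n ∸ i) ((n ∸ i) +ℕ j ∸ 1)

-- T2: y^{(b+1)}_{a+1} = h_{a+1,b+1} - h_{a,b+1}; with i = b+1, j = a+1:
--   y^{(i)}_j = h_{j,i} - h_{j-1,i}
T₂ : ℕ → HArray → TArray
T₂ n H i j = + H j i - + H (j ∸ 1) i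

module Submission where

-- Read the h-array in reflected coordinates, G r h = h_{n-r,n-h}.
-- Then the dual array S = T₁*(H) is a row-wise difference array,
-- s^{(r)}_h = G r h - G r (h-1), so in the exponent ε^{(i)}_j(S) the sum of
-- second row-differences telescopes.  What is left consists of
--   * two column differences of G, which are (minus) entries of T₂(H), and
--   * the second difference of the last column h_{·,n} of H, which by the
--     boundary conditions of 𝓗(μ,ν,λ) equals ν_{n-i} - ν_{n+1-i}.
-- This gives, for 1 ≤ j ≤ i ≤ n-1, with b = n-j and a = n-i,
--   ε^{(i)}_j(S) = (y^{(b+1)}_{a+1} - y^{(b)}_a) + (ν*_i - ν*_{i+1}),
-- so the bound ε^{(i)}_j(S) ≤ ν*_i - ν*_{i+1} is exactly the IC(2) inequality
-- y^{(b+1)}_{a+1} ≤ y^{(b)}_a.  Since (i,j) ↦ (n-j, n-i) maps the index range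
-- {1 ≤ j ≤ i ≤ n-1} onto itself, the proposition follows.

open import Defs
open import Data.Nat using (ℕ; _<_; _≤_; zero; suc; _∸_; z≤n; s≤s) renaming (_+_ to _+ℕ_)
open import Data.Integer using (ℤ; +_; _+_; _-_; -_; _*_) renaming (_≤_ to _≤ℤ_)
open import Function.Bundles using (_⇔_; mk⇔; module Equivalence)
open import Data.Product using (_,_)
import Data.Nat.Properties as ℕP
import Data.Integer.Properties as ℤP
open import Relation.Binary.PropositionalEquality
open import Data.Integer.Tactic.RingSolver using (solve-∀)

∸-suc : ∀ n k → k < n → n ∸ k ≡ suc (n ∸ suc k)
∸-suc (suc n) zero    _       = refl
∸-suc (suc n) (suc k) (s≤s p) = ∸-suc n k p

∸-one : ∀ n h → n ∸ h ∸ 1 ≡ n ∸ suc h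
∸-one n h = trans (ℕP.∸-+-assoc n h 1) (cong (n ∸_) (ℕP.+-comm h 1))

∸-+-∸ : ∀ n r h → h ≤ r → r ≤ n → (n ∸ r) +ℕ (r ∸ h) ≡ n ∸ h
∸-+-∸ n r h h≤r r≤n = begin
  (n ∸ r) +ℕ (r ∸ h)  ≡⟨ ℕP.+-∸-assoc (n ∸ r) h≤r ⟨
  (n ∸ r) +ℕ r ∸ h    ≡⟨ cong (_∸ h) (ℕP.m∸n+n≡m r≤n) ⟩
  n ∸ h               ∎
  where open ≡-Reasoning

telescope : ∀ (f F : ℕ → ℤ) k → (∀ h → h < k → f (suc h) ≡ F (suc h) - F h) →
            sumTo k f ≡ F k - F 0
telescope f F zero    _    = sym (ℤP.+-inverseʳ (F 0))
telescope f F (suc k) diff =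
  trans (cong₂ _+_ (telescope f F k (λ h h<k → diff h (ℕP.m≤n⇒m≤1+n h<k)))
                   (diff k ℕP.≤-refl))
        (chain (F (suc k)) (F k) (F 0))
  where
  chain : ∀ a b c → (b - c) + (a - b) ≡ a - c
  chain = solve-∀

difference-≤ : ∀ X Y R → X ≤ℤ Y ⇔ (X - Y) + R ≤ℤ R
difference-≤ X Y R = mk⇔ to from
  where
  to : X ≤ℤ Y → (X - Y) + R ≤ℤ R
  to X≤Y = subst ((X - Y) + R ≤ℤ_) (ℤP.+-identityˡ R)
                 (ℤP.+-monoˡ-≤ R (ℤP.i≤j⇒i-j≤0 X≤Y))
  cancel : ∀ x y r → ((x - y) + r) + - r ≡ x - y
  cancel = solve-∀
  from : (X - Y) + R ≤ℤ R → X ≤ℤ Y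
  from p = ℤP.i-j≤0⇒i≤j (subst₂ _≤ℤ_ (cancel X Y R) (ℤP.+-inverseʳ R) (ℤP.+-monoˡ-≤ (- R) p))

-- The second difference of rows i, i+1, i+2 of an array, in column h;
-- the summands of the exponent ε^{(i+1)} are exactly these.
secondDiff : (ℕ → ℕ → ℤ) → ℕ → ℕ → ℤ
secondDiff G i h = G (suc (suc i)) h - + 2 * G (suc i) h + G i h

-- If every row of S (up to row m) is the sequence of differences of the
-- corresponding row of G, the sum in the exponent telescopes and only
-- column differences of G and the second difference at column 0 remain.
exponent-of-differences :
  (S : TArray) (G : ℕ → ℕ → ℤ) (m : ℕ) →
  (∀ r h → h < r → r ≤ m → S r (suc h) ≡ G r (suc h) - G r h) →
  ∀ i j → j ≤ i → suc i < m →
  exponent S (suc i) (suc j) ≡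
    ((G (suc (suc i)) (suc j) - G (suc i) (suc j)) - (G (suc i) j - G i j))
    - secondDiff G i 0
exponent-of-differences S G m rowDiff i j j≤i i<m = begin
  exponent S (suc i) (suc j)
    ≡⟨ cong₂ _+_ (telescope (secondDiff S i) (secondDiff G i) j columnStep)
                 (cong₂ _-_ (rowDiff (suc (suc i)) j (s≤s (ℕP.m≤n⇒m≤1+n j≤i)) i<m)
                            (rowDiff (suc i) j (s≤s j≤i) (ℕP.<⇒≤ i<m))) ⟩
  (secondDiff G i j - secondDiff G i 0)
    + ((G (suc (suc i)) (suc j) - G (suc (suc i)) j) - (G (suc i) (suc j) - G (suc i) j))
    ≡⟨ regroup (G (suc (suc i)) (suc j)) (G (suc (suc i)) j) (G (suc i) (suc j))
               (G (suc i) j) (G i j) (secondDiff G i 0) ⟩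
  ((G (suc (suc i)) (suc j) - G (suc i) (suc j)) - (G (suc i) j - G i j))
    - secondDiff G i 0 ∎
  where
  open ≡-Reasoning
  regroup : ∀ a' a b' b c d →
    ((a - + 2 * b + c) - d) + ((a' - a) - (b' - b)) ≡ ((a' - b') - (b - c)) - d
  regroup = solve-∀
  linear : ∀ a' a b' b c' c →
    (a' - a) - + 2 * (b' - b) + (c' - c) ≡ (a' - + 2 * b' + c') - (a - + 2 * b + c)
  linear = solve-∀
  columnStep : ∀ h → h < j → secondDiff S i (suc h) ≡ secondDiff G i (suc h) - secondDiff G i h
  columnStep h h<j = belowRow h (ℕP.<-≤-trans h<j j≤i)
    where
    belowRow : ∀ h → h < i → secondDiff S i (suc h) ≡ secondDiff G i (suc h) - secondDiff G i h
    belowRow h h<i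
      rewrite rowDiff (suc (suc i)) h (ℕP.m≤n⇒m≤1+n (ℕP.m≤n⇒m≤1+n h<i)) i<m
            | rowDiff (suc i) h (ℕP.m≤n⇒m≤1+n h<i) (ℕP.<⇒≤ i<m)
            | rowDiff i h h<i (ℕP.≤-trans (ℕP.n≤1+n i) (ℕP.<⇒≤ i<m))
      = linear (G (suc (suc i)) (suc h)) (G (suc (suc i)) h) (G (suc i) (suc h)) (G (suc i) h)
               (G i (suc h)) (G i h)

IC2-at : TArray → ℕ → ℕ → Set
IC2-at T b a = T (suc b) (suc a) ≤ℤ T b a

reflect-range : ∀ n (P : ℕ → ℕ → Set) →
  (∀ i j → 1 ≤ j → j ≤ i → i < n → P (n ∸ j) (n ∸ i)) ⇔
  (∀ b a → 1 ≤ a → a ≤ b → b < n → P b a)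
reflect-range n P = mk⇔ to from
  where
  to : (∀ i j → 1 ≤ j → j ≤ i → i < n → P (n ∸ j) (n ∸ i)) →
       (∀ b a → 1 ≤ a → a ≤ b → b < n → P b a)
  to p b a 1≤a a≤b b<n =
    subst₂ P (ℕP.m∸[m∸n]≡n (ℕP.<⇒≤ b<n)) (ℕP.m∸[m∸n]≡n a≤n)
      (p (n ∸ a) (n ∸ b) (ℕP.m<n⇒0<n∸m b<n) (ℕP.∸-monoʳ-≤ n a≤b)
         (ℕP.∸-monoʳ-< {n} {a} {0} 1≤a a≤n))
    where
    a≤n : a ≤ n
    a≤n = ℕP.≤-trans a≤b (ℕP.<⇒≤ b<n)
  from : (∀ b a → 1 ≤ a → a ≤ b → b < n → P b a) →
         (∀ i j → 1 ≤ j → j ≤ i → i < n → P (n ∸ j) (n ∸ i))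
  from p i j 1≤j j≤i i<n =
    p (n ∸ j) (n ∸ i) (ℕP.m<n⇒0<n∸m i<n) (ℕP.∸-monoʳ-≤ n j≤i)
      (ℕP.∸-monoʳ-< {n} {j} {0} 1≤j (ℕP.≤-trans j≤i (ℕP.<⇒≤ i<n)))

module HArrayFacts (n : ℕ) (μ ν : Weight) (H : HArray)
  (firstRow   : ∀ i → 1 ≤ i → i ≤ n → H 0 i ≡ sumToℕ i μ)
  (lastColumn : ∀ i → 1 ≤ i → i ≤ n → H i n ≡ sumToℕ n μ +ℕ sumToℕ i ν) where

  reflected : ℕ → ℕ → ℤ
  reflected r h = + H (n ∸ r) (n ∸ h)

  dualT₁-differences : ∀ r h → h < r → r ≤ n →
    dualArray (T₁ n H) r (suc h) ≡ reflected r (suc h) - reflected r h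
  dualT₁-differences r h h<r r≤n
    rewrite ∸-+-∸ n r h (ℕP.<⇒≤ h<r) r≤n | ∸-one n h
    = negate-difference (reflected r h) (reflected r (suc h))
    where
    negate-difference : ∀ x y → - (x - y) ≡ y - x
    negate-difference = solve-∀

  T₂-column-difference : ∀ r h → T₂ n H (n ∸ h) (n ∸ r) ≡ reflected r h - reflected (suc r) h
  T₂-column-difference r h = cong (λ a → + H (n ∸ r) (n ∸ h) - + H a (n ∸ h)) (∸-one n r)

  -- Every entry of the last column above the diagonal is |μ| plus a partial sum
  -- of ν (for the top entry this is the first-row condition).
  lastColumn-partialSums : ∀ x → suc x ≤ n → H x n ≡ sumToℕ n μ +ℕ sumToℕ x ν
  lastColumn-partialSums zero    1≤n = trans (firstRow n 1≤n ℕP.≤-refl) (sym (ℕP.+-identityʳ _))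
  lastColumn-partialSums (suc x) x<n = lastColumn (suc x) (s≤s z≤n) (ℕP.<⇒≤ x<n)

  lastColumn-step : ∀ x → suc x ≤ n → + H (suc x) n ≡ + H x n + + ν (suc x)
  lastColumn-step x sx≤n = trans (cong +_ (trans (lastColumn (suc x) (s≤s z≤n) sx≤n) shift))
                                 (ℤP.pos-+ (H x n) (ν (suc x)))
    where
    shift : sumToℕ n μ +ℕ (sumToℕ x ν +ℕ ν (suc x)) ≡ H x n +ℕ ν (suc x)
    shift = trans (sym (ℕP.+-assoc (sumToℕ n μ) _ _))
                  (cong (_+ℕ ν (suc x)) (sym (lastColumn-partialSums x sx≤n)))

  lastColumn-secondDiff : ∀ a → suc (suc a) ≤ n →
    + H a n - + 2 * + H (suc a) n + + H (suc (suc a)) n ≡ + ν (suc (suc a)) - + ν (suc a)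
  lastColumn-secondDiff a ssa≤n
    = trans (cong₂ (λ x y → + H a n - + 2 * x + y) step₁
                   (trans (lastColumn-step (suc a) ssa≤n) (cong (_+ + ν (suc (suc a))) step₁)))
            (increments (+ H a n) (+ ν (suc a)) (+ ν (suc (suc a))))
    where
    increments : ∀ p v₁ v₂ → p - + 2 * (p + v₁) + ((p + v₁) + v₂) ≡ v₂ - v₁
    increments = solve-∀
    step₁ : + H (suc a) n ≡ + H a n + + ν (suc a)
    step₁ = lastColumn-step a (ℕP.<⇒≤ ssa≤n)

  secondDiff-column0 : ∀ i → suc i < n →
    secondDiff reflected i 0 ≡ + ν (n ∸ i) - + ν (n ∸ suc i)
  secondDiff-column0 i si<n
    rewrite ∸-suc n i (ℕP.<⇒≤ si<n) | ∸-suc n (suc i) si<n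
    = lastColumn-secondDiff (n ∸ suc (suc i))
        (subst (_≤ n) (trans (∸-suc n i (ℕP.<⇒≤ si<n)) (cong suc (∸-suc n (suc i) si<n)))
               (ℕP.m∸n≤m n i))

  exponent-identity : ∀ i j → 1 ≤ j → j ≤ i → i < n →
    exponent (dualArray (T₁ n H)) i j ≡
      (T₂ n H (suc (n ∸ j)) (suc (n ∸ i)) - T₂ n H (n ∸ j) (n ∸ i))
      + (dualWeight n ν i - dualWeight n ν (suc i))
  exponent-identity (suc i) (suc j) _ (s≤s j≤i) si<n = begin
    exponent (dualArray (T₁ n H)) (suc i) (suc j)
      ≡⟨ exponent-of-differences (dualArray (T₁ n H)) reflected n dualT₁-differences i j j≤i si<n ⟩
    ((reflected (suc (suc i)) (suc j) - reflected (suc i) (suc j))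
      - (reflected (suc i) j - reflected i j)) - secondDiff reflected i 0
      ≡⟨ cong₂ _-_ (swap-differences (reflected (suc (suc i)) (suc j)) (reflected (suc i) (suc j))
                                     (reflected (suc i) j) (reflected i j))
                   (secondDiff-column0 i si<n) ⟩
    ((reflected i j - reflected (suc i) j)
      - (reflected (suc i) (suc j) - reflected (suc (suc i)) (suc j)))
      - (+ ν (n ∸ i) - + ν (n ∸ suc i))
      ≡⟨ cong₂ (λ x y → (x - y) - (+ ν (n ∸ i) - + ν (n ∸ suc i)))
               (sym (T₂-column-difference i j)) (sym (T₂-column-difference (suc i) (suc j))) ⟩
    (T₂ n H (n ∸ j) (n ∸ i) - T₂ n H (n ∸ suc j) (n ∸ suc i))
      - (+ ν (n ∸ i) - + ν (n ∸ suc i))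
      ≡⟨ cong₂ (λ b a → (T₂ n H b a - T₂ n H (n ∸ suc j) (n ∸ suc i))
                          - (+ ν (n ∸ i) - + ν (n ∸ suc i)))
               (∸-suc n j (ℕP.≤-trans (s≤s j≤i) (ℕP.<⇒≤ si<n))) (∸-suc n i (ℕP.<⇒≤ si<n)) ⟩
    (T₂ n H (suc (n ∸ suc j)) (suc (n ∸ suc i)) - T₂ n H (n ∸ suc j) (n ∸ suc i))
      - (+ ν (n ∸ i) - + ν (n ∸ suc i))
      ≡⟨ subtract-difference
           (T₂ n H (suc (n ∸ suc j)) (suc (n ∸ suc i)) - T₂ n H (n ∸ suc j) (n ∸ suc i))
           (+ ν (n ∸ i)) (+ ν (n ∸ suc i)) ⟩
    (T₂ n H (suc (n ∸ suc j)) (suc (n ∸ suc i)) - T₂ n H (n ∸ suc j) (n ∸ suc i))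
      + (dualWeight n ν (suc i) - dualWeight n ν (suc (suc i))) ∎
    where
    open ≡-Reasoning
    swap-differences : ∀ x y z w → (x - y) - (z - w) ≡ (w - z) - (y - x)
    swap-differences = solve-∀
    subtract-difference : ∀ x p q → x - (p - q) ≡ x + (- p - - q)
    subtract-difference = solve-∀

  exponentBound⇔IC2 : ∀ i j → 1 ≤ j → j ≤ i → i < n →
    IC2-at (T₂ n H) (n ∸ j) (n ∸ i) ⇔
    (exponent (dualArray (T₁ n H)) i j ≤ℤ dualWeight n ν i - dualWeight n ν (suc i))
  exponentBound⇔IC2 i j 1≤j j≤i i<n =
    subst (λ e → IC2-at (T₂ n H) (n ∸ j) (n ∸ i) ⇔ (e ≤ℤ _))
          (sym (exponent-identity i j 1≤j j≤i i<n))
          (difference-≤ _ _ _)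

proposition3p6 : (n : ℕ) (μ ν λw : Weight) →
    Dominant n μ → Dominant n ν → Dominant n λw →
    (H : HArray) → InH n μ ν λw H →
    ((∀ i j → 1 ≤ j → j ≤ i → i < n →
    exponent (dualArray (T₁ n H)) i j ≤ℤ dualWeight n ν i - dualWeight n ν (Data.Nat.suc i))
    ⇔ IC2 n (T₂ n H))
proposition3p6 n μ ν λw _ _ _ H (_ , firstRow , lastColumn , _) = mk⇔
  (λ bound → to reflection (λ i j 1≤j j≤i i<n →
     from (exponentBound⇔IC2 i j 1≤j j≤i i<n) (bound i j 1≤j j≤i i<n)))
  (λ ic2 i j 1≤j j≤i i<n →
     to (exponentBound⇔IC2 i j 1≤j j≤i i<n) (from reflection ic2 i j 1≤j j≤i i<n))
  where
  open HArrayFacts n μ ν H firstRow lastColumn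
  open Equivalence
  reflection : (∀ i j → 1 ≤ j → j ≤ i → i < n → IC2-at (T₂ n H) (n ∸ j) (n ∸ i)) ⇔ IC2 n (T₂ n H)
  reflection = reflect-range n (IC2-at (T₂ n H))
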